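{- Let $\mathcal{T}$ be a set of binary phylogenetic $X$-trees, let $S=\langle (x_1,y_1),\dots,(x_r,y_r),(x_{r+1},-)\rangle$ be a tree-child cherry picking sequence for $\mathcal{T}$, let $0\le j\le r$, and suppose that $\{x,y\}$ is a trivial cherry of $\mathcal{T}^{(j)}$ and $y$ is not forbidden with respect to $S_{1,j}$. Then there exists a tree-child cherry picking sequence $S'$ for $\mathcal{T}$ such that $|S'|=|S|$, $S'_{1,j}=S_{1,j}$, and $(x,y)$ is a pair in $S'_{j+1,r}$.
   Context: A binary phylogenetic $X'$-tree is a rooted tree whose root has out-degree 2, whose internal non-root nodes have in-degree 1 and out-degree 2, and whose leaves are bijectively labelled by $X'$ (or a single node if $|X'|=1$). A pair $\{x,y\}$ is a cherry of a tree if leaves $x,y$ are siblings. For a set of trees $\mathcal{T}$, $\{x,y\}$ is a cherry of $\mathcal{T}$ if it is a cherry of at least one tree in $\mathcal{T}$, and a trivial cherry of $\mathcal{T}$ if moreover it is a cherry of every tree in $\mathcal{T}$ containing both $x$ and $y$. A cherry picking sequence is a sequence $S=\langle (x_1,y_1),\dots,(x_r,y_r),(x_{r+1},-),\dots,(x_s,-)\rangle$ with $x_i,y_i\in X$; $|S|=s$; $S_{i,j}$ is the subsequence of the $i$th through $j$th elements (empty if $j<i$). Applying $S$ to a tree $T$: $T^{(0)}=T$, and for $j\le r$, if $\{x_j,y_j\}$ is a cherry of $T^{(j-1)}$ then $T^{(j)}$ is obtained by deleting leaf $x_j$ and suppressing the parent of $y_j$, otherwise $T^{(j)}=T^{(j-1)}$;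 $T/S=T^{(r)}$; $\mathcal{T}^{(j)}=\{T^{(j)}:T\in\mathcal{T}\}$. $S$ is a cherry picking sequence for a set $\mathcal{T}$ of $X$-trees if $s>r$, $\{x_1,\dots,x_s\}=X$, and each $T/S$ ($T\in\mathcal{T}$) is a single leaf in $\{x_{r+1},\dots,x_s\}$. $S$ is tree-child if $s\le r+1$ and $y_j\ne x_i$ for all $1\le i<j\le s$. A leaf $y$ is forbidden with respect to $\langle (x_1,y_1),\dots,(x_j,y_j)\rangle$ if $y\in\{x_1,\dots,x_j\}$. -}

module Defs where

open import Data.Nat using (ℕ; _≡ᵇ_; _≤_; _+_)
open import Data.Bool using (Bool; true; false; _∧_; _∨_; if_then_else_; T)
open import Data.List using (List; []; _∷_; _++_; map; length; take; drop; foldl)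
open import Data.List.Membership.Propositional using (_∈_; _∉_)
open import Data.List.Relation.Unary.All using (All)
open import Data.List.Relation.Unary.Any using (Any)
open import Data.List.Relation.Unary.Unique.Propositional using (Unique)
open import Data.List.Relation.Binary.Permutation.Propositional using (_↭_)
open import Data.Product using (_×_; _,_; proj₁; proj₂; ∃)
open import Relation.Binary.PropositionalEquality using (_≡_)
open import Relation.Nullary using (¬_)
open import Function.Bundles using (_⇔_)

-- Every internal node has exactly two children (root out-degree 2,
-- internal nodes in-degree 1 / out-degree 2); a single leaf is the |X| = 1 case.
data Tree : Set where
  leaf : ℕ → Tree
  node : Tree → Tree → Tree

leaves : Tree → List ℕ
leaves (leaf z)   = z ∷ []
leaves (node l r) = leaves l ++ leaves r

PhyloTree : List ℕ → Tree → Set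
PhyloTree X t = leaves t ↭ X

cherryNode : ℕ → ℕ → Tree → Tree → Bool
cherryNode x y (leaf a) (leaf b) = ((a ≡ᵇ x) ∧ (b ≡ᵇ y)) ∨ ((a ≡ᵇ y) ∧ (b ≡ᵇ x))
cherryNode x y _ _ = false

cherryᵇ : ℕ → ℕ → Tree → Bool
cherryᵇ x y (leaf _)   = false
cherryᵇ x y (node l r) = cherryNode x y l r ∨ cherryᵇ x y l ∨ cherryᵇ x y r

Cherry : ℕ → ℕ → Tree → Set
Cherry x y t = T (cherryᵇ x y t)

reduce : ℕ → ℕ → Tree → Tree
reduce x y (leaf z)   = leaf z
reduce x y (node l r) =
  if cherryNode x y l r then leaf y else node (reduce x y l) (reduce x y r)

step : Tree → ℕ × ℕ → Tree
step t (x , y) = if cherryᵇ x y t then reduce x y t else t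

applyPairs : List (ℕ × ℕ) → Tree → Tree
applyPairs ps t = foldl step t ps

CherryOfSet : ℕ → ℕ → List Tree → Set
CherryOfSet x y Ts = Any (Cherry x y) Ts

TrivialCherry : ℕ → ℕ → List Tree → Set
TrivialCherry x y Ts =
  CherryOfSet x y Ts ×
  All (λ t → x ∈ leaves t → y ∈ leaves t → Cherry x y t) Ts

record Seq : Set where
  constructor mkSeq
  field
    pairs  : List (ℕ × ℕ)   -- (x1,y1) ... (xr,yr)
    finals : List ℕ         -- x_{r+1} ... x_s
open Seq public

seqLength : Seq → ℕ
seqLength S = length (pairs S) + length (finals S)

xsOf : Seq → List ℕ
xsOf S = map proj₁ (pairs S) ++ finals S

applySet : List (ℕ × ℕ) → List Tree → List Tree
applySet ps Ts = map (applyPairs ps) Ts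

IsCPS : List ℕ → List Tree → Seq → Set
IsCPS X Ts S =
  (¬ (finals S ≡ [])) ×                                          -- s > r
  All (λ p → proj₁ p ∈ X × proj₂ p ∈ X) (pairs S) ×
  All (λ z → z ∈ X) (finals S) ×
  (∀ z → z ∈ X → z ∈ xsOf S) ×
  All (λ t → ∃ λ z → applyPairs (pairs S) t ≡ leaf z × z ∈ finals S) Ts

IsTreeChild : Seq → Set
IsTreeChild S =
  length (finals S) ≤ 1 ×
  (∀ pre p post → pairs S ≡ pre ++ (p ∷ post) → proj₂ p ∉ map proj₁ pre)

Forbidden : ℕ → List (ℕ × ℕ) → Set
Forbidden y ps = y ∈ map proj₁ ps

-- If (x , y) already occurs after position j, S itself will do. Otherwise the cherry {x,y}, present
-- in every tree after the first j pairs, still has to be reduced, so (y , x) occurs after position j;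
-- split S = P ++ A ++ (y , x) ∷ B at its first occurrence. While {x,y} is a cherry, the pairs of A
-- that mention x or y do nothing (a leaf has only one sibling), so they can be replaced by the
-- equally inert (x , y). Picking (x , y) right after P therefore yields, once A has been applied,
-- the tree that picking (y , x) yields with the labels x and y exchanged; relabelling B by this
-- transposition, every tree is reduced to the transposed final leaf. The new sequence is still
-- tree-child since x is not forbidden before (y , x) and y is not forbidden in P.
module Submission where

open import Data.Bool using (true; false)
open import Data.Empty using (⊥-elim)
open import Data.List using (List; []; _∷_; _++_; [_]; map; length; take; drop)
open import Data.List.Membership.Propositional using (_∈_; _∉_; find)
open import Data.List.Membership.Propositional.Properties using (∈-++⁺ˡ; ∈-++⁺ʳ; ∈-++⁻; ∈-map⁺; ∈-map⁻)
open import Data.List.Properties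
  using (++-identityʳ; ++-assoc; map-++; foldl-++; length-map; length-++-sucʳ; length-take; take-all; take++drop≡id)
open import Data.List.Relation.Binary.Disjoint.Propositional using (Disjoint)
open import Data.List.Relation.Binary.Permutation.Propositional using (↭-sym; ↭⇒↭ₛ)
open import Data.List.Relation.Binary.Permutation.Propositional.Properties using (∈-resp-↭)
import Data.List.Relation.Binary.Permutation.Setoid.Properties as Perm
open import Data.List.Relation.Binary.Subset.Propositional using (_⊆_)
import Data.List.Relation.Binary.Subset.Propositional.Properties as Subset
open import Data.List.Relation.Unary.All as All using (All; []; _∷_)
import Data.List.Relation.Unary.All.Properties as All
open import Data.List.Relation.Unary.AllPairs using ([]; _∷_)
open import Data.List.Relation.Unary.Any using (here; there; any?)
import Data.List.Relation.Unary.Any.Properties as Any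
import Data.List.Relation.Unary.First as First
open import Data.List.Relation.Unary.First.Properties using (toView)
open import Data.List.Relation.Unary.Unique.Propositional using (Unique)
open import Data.Nat using (ℕ; suc; _≤_; _≡ᵇ_; s≤s; z≤n)
open import Data.Nat.Properties using (_≟_; ≡ᵇ⇒≡; ≡⇒≡ᵇ; ≤-refl; ≤-reflexive; m≤n⇒m⊓n≡m)
open import Data.List.Membership.DecPropositional _≟_ using (_∈?_)
open import Data.Product using (_×_; _,_; proj₁; proj₂; ∃; ∃₂)
import Data.Product as Product
open import Data.Product.Properties using (≡-dec)
open import Data.Sum using (_⊎_; inj₁; inj₂)
import Data.Sum as Sum
open import Data.Unit using (⊤; tt)
open import Function using (_∘_)
open import Function.Definitions using (Injective)
open import Relation.Binary.PropositionalEquality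
  using (_≡_; _≢_; refl; sym; trans; cong; cong₂; subst; setoid; module ≡-Reasoning)
open import Relation.Nullary using (¬_; Dec; yes; no; _because_)
open import Relation.Nullary.Decidable using (_⊎-dec_; toSum)
open import Relation.Nullary.Reflects using (Reflects; ofʸ; ofⁿ; fromEquivalence; _×-reflects_; _⊎-reflects_)

open import Defs

reflects-⇔ : ∀ {A B : Set} {b} → (A → B) → (B → A) → Reflects A b → Reflects B b
reflects-⇔ to from (ofʸ a)  = ofʸ (to a)
reflects-⇔ to from (ofⁿ ¬a) = ofⁿ (¬a ∘ from)

data CherryNode (a b : ℕ) : Tree → Tree → Set where
  ab : CherryNode a b (leaf a) (leaf b)
  ba : CherryNode a b (leaf b) (leaf a)

data HasCherry (a b : ℕ) : Tree → Set where
  root  : ∀ {l r} → CherryNode a b l r → HasCherry a b (node l r)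
  left  : ∀ {l r} → HasCherry a b l → HasCherry a b (node l r)
  right : ∀ {l r} → HasCherry a b r → HasCherry a b (node l r)

CherryNode-leaves⁻ : ∀ {a b p q} → CherryNode a b (leaf p) (leaf q) → (p ≡ a × q ≡ b) ⊎ (p ≡ b × q ≡ a)
CherryNode-leaves⁻ ab = inj₁ (refl , refl)
CherryNode-leaves⁻ ba = inj₂ (refl , refl)

≡ᵇ-reflects : ∀ m n → Reflects (m ≡ n) (m ≡ᵇ n)
≡ᵇ-reflects m n = fromEquivalence (≡ᵇ⇒≡ m n) (≡⇒≡ᵇ m n)

cherryNode-reflects : ∀ a b l r → Reflects (CherryNode a b l r) (cherryNode a b l r)
cherryNode-reflects a b (leaf p) (leaf q) =
  reflects-⇔ to CherryNode-leaves⁻ ((≡ᵇ-reflects p a ×-reflects ≡ᵇ-reflects q b) ⊎-reflects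
                                    (≡ᵇ-reflects p b ×-reflects ≡ᵇ-reflects q a))
  where
  to : (p ≡ a × q ≡ b) ⊎ (p ≡ b × q ≡ a) → CherryNode a b (leaf p) (leaf q)
  to (inj₁ (refl , refl)) = ab
  to (inj₂ (refl , refl)) = ba
cherryNode-reflects a b (leaf _)   (node _ _) = ofⁿ λ ()
cherryNode-reflects a b (node _ _) _          = ofⁿ λ ()

cherryᵇ-reflects : ∀ a b t → Reflects (HasCherry a b t) (cherryᵇ a b t)
cherryᵇ-reflects a b (leaf _)   = ofⁿ λ ()
cherryᵇ-reflects a b (node l r) =
  reflects-⇔ to from (cherryNode-reflects a b l r ⊎-reflects
                      cherryᵇ-reflects a b l ⊎-reflects cherryᵇ-reflects a b r)
  where
  to : CherryNode a b l r ⊎ HasCherry a b l ⊎ HasCherry a b r → HasCherry a b (node l r)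
  to (inj₁ c)        = root c
  to (inj₂ (inj₁ h)) = left h
  to (inj₂ (inj₂ h)) = right h
  from : HasCherry a b (node l r) → CherryNode a b l r ⊎ HasCherry a b l ⊎ HasCherry a b r
  from (root c)  = inj₁ c
  from (left h)  = inj₂ (inj₁ h)
  from (right h) = inj₂ (inj₂ h)

cherryNode? : ∀ a b l r → Dec (CherryNode a b l r)
cherryNode? a b l r = cherryNode a b l r because cherryNode-reflects a b l r

hasCherry? : ∀ a b t → Dec (HasCherry a b t)
hasCherry? a b t = cherryᵇ a b t because cherryᵇ-reflects a b t

Cherry⇒HasCherry : ∀ {a b} t → Cherry a b t → HasCherry a b t
Cherry⇒HasCherry {a} {b} t with cherryᵇ a b t | cherryᵇ-reflects a b t
... | true  | ofʸ h = λ _ → h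
... | false | _     = λ ()

reduce-picks : ∀ {a b l r} → CherryNode a b l r → reduce a b (node l r) ≡ leaf b
reduce-picks {a} {b} {l} {r} c with cherryNode a b l r | cherryNode-reflects a b l r
... | true  | _      = refl
... | false | ofⁿ ¬c = ⊥-elim (¬c c)

reduce-skips : ∀ {a b l r} → ¬ CherryNode a b l r →
               reduce a b (node l r) ≡ node (reduce a b l) (reduce a b r)
reduce-skips {a} {b} {l} {r} ¬c with cherryNode a b l r | cherryNode-reflects a b l r
... | true  | ofʸ c = ⊥-elim (¬c c)
... | false | _     = refl

step-picks : ∀ {a b t} → HasCherry a b t → step t (a , b) ≡ reduce a b t
step-picks {a} {b} {t} h with cherryᵇ a b t | cherryᵇ-reflects a b t
... | true  | _      = refl
... | false | ofⁿ ¬h = ⊥-elim (¬h h)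

step-skips : ∀ {a b t} → ¬ HasCherry a b t → step t (a , b) ≡ t
step-skips {a} {b} {t} ¬h with cherryᵇ a b t | cherryᵇ-reflects a b t
... | true  | ofʸ h = ⊥-elim (¬h h)
... | false | _     = refl

¬HasCherry-leaf : ∀ {a b z} → ¬ HasCherry a b (leaf z)
¬HasCherry-leaf ()

HasCherry⇒¬CherryNodeˡ : ∀ {u v a b l r} → HasCherry u v l → ¬ CherryNode a b l r
HasCherry⇒¬CherryNodeˡ () ab
HasCherry⇒¬CherryNodeˡ () ba

HasCherry⇒¬CherryNodeʳ : ∀ {u v a b l r} → HasCherry u v r → ¬ CherryNode a b l r
HasCherry⇒¬CherryNodeʳ () ab
HasCherry⇒¬CherryNodeʳ () ba

CherryNode-sym : ∀ {a b l r} → CherryNode a b l r → CherryNode b a l r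
CherryNode-sym ab = ba
CherryNode-sym ba = ab

HasCherry-sym : ∀ {a b t} → HasCherry a b t → HasCherry b a t
HasCherry-sym (root c)  = root (CherryNode-sym c)
HasCherry-sym (left h)  = left (HasCherry-sym h)
HasCherry-sym (right h) = right (HasCherry-sym h)

CherryNode⇒∈ : ∀ {u v a b l r} → CherryNode u v l r → CherryNode a b l r → a ∈ u ∷ v ∷ []
CherryNode⇒∈ ab ab = here refl
CherryNode⇒∈ ab ba = there (here refl)
CherryNode⇒∈ ba ab = there (here refl)
CherryNode⇒∈ ba ba = here refl

∈-CherryNode : ∀ {a b l r z} → CherryNode a b l r → z ∈ leaves (node l r) → z ≡ a ⊎ z ≡ b
∈-CherryNode ab (here z≡a)         = inj₁ z≡a
∈-CherryNode ab (there (here z≡b)) = inj₂ z≡b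
∈-CherryNode ba (here z≡b)         = inj₂ z≡b
∈-CherryNode ba (there (here z≡a)) = inj₁ z≡a

HasCherry⇒∈leaves : ∀ {a b t} → HasCherry a b t → a ∈ leaves t × b ∈ leaves t
HasCherry⇒∈leaves (root ab) = here refl , there (here refl)
HasCherry⇒∈leaves (root ba) = there (here refl) , here refl
HasCherry⇒∈leaves {t = node l r} (left h) =
  let a∈ , b∈ = HasCherry⇒∈leaves h in ∈-++⁺ˡ a∈ , ∈-++⁺ˡ b∈
HasCherry⇒∈leaves {t = node l r} (right h) =
  let a∈ , b∈ = HasCherry⇒∈leaves h in ∈-++⁺ʳ (leaves l) a∈ , ∈-++⁺ʳ (leaves l) b∈

∈-leaves-reduce⁻ : ∀ a b t {z} → z ∈ leaves (reduce a b t) → z ∈ leaves t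
∈-leaves-reduce⁻ a b (leaf _)   z∈ = z∈
∈-leaves-reduce⁻ a b (node l r) z∈ with cherryNode? a b l r
... | yes c rewrite reduce-picks c with z∈
...   | here refl = proj₂ (HasCherry⇒∈leaves (root c))
∈-leaves-reduce⁻ a b (node l r) z∈ | no ¬c rewrite reduce-skips ¬c with ∈-++⁻ (leaves (reduce a b l)) z∈
...   | inj₁ z∈l = ∈-++⁺ˡ (∈-leaves-reduce⁻ a b l z∈l)
...   | inj₂ z∈r = ∈-++⁺ʳ (leaves l) (∈-leaves-reduce⁻ a b r z∈r)

∈-leaves-reduce⁺ : ∀ a b t {z} → z ∈ leaves t → z ≢ a → z ∈ leaves (reduce a b t)
∈-leaves-reduce⁺ a b (leaf _)   z∈ _ = z∈
∈-leaves-reduce⁺ a b (node l r) z∈ z≢a with cherryNode? a b l r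
... | yes c rewrite reduce-picks c with ∈-CherryNode c z∈
...   | inj₁ z≡a  = ⊥-elim (z≢a z≡a)
...   | inj₂ refl = here refl
∈-leaves-reduce⁺ a b (node l r) z∈ z≢a | no ¬c rewrite reduce-skips ¬c with ∈-++⁻ (leaves l) z∈
...   | inj₁ z∈l = ∈-++⁺ˡ (∈-leaves-reduce⁺ a b l z∈l z≢a)
...   | inj₂ z∈r = ∈-++⁺ʳ (leaves (reduce a b l)) (∈-leaves-reduce⁺ a b r z∈r z≢a)

∈-leaves-step⁻ : ∀ t p {z} → z ∈ leaves (step t p) → z ∈ leaves t
∈-leaves-step⁻ t (a , b) z∈ with hasCherry? a b t
... | yes h rewrite step-picks h = ∈-leaves-reduce⁻ a b t z∈
... | no ¬h rewrite step-skips ¬h = z∈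

∈-leaves-step⁺ : ∀ t p {z} → z ∈ leaves t → z ≢ proj₁ p → z ∈ leaves (step t p)
∈-leaves-step⁺ t (a , b) z∈ z≢a with hasCherry? a b t
... | yes h rewrite step-picks h = ∈-leaves-reduce⁺ a b t z∈ z≢a
... | no ¬h rewrite step-skips ¬h = z∈

∈-leaves-applyPairs⁻ : ∀ ps t {z} → z ∈ leaves (applyPairs ps t) → z ∈ leaves t
∈-leaves-applyPairs⁻ []       t z∈ = z∈
∈-leaves-applyPairs⁻ (p ∷ ps) t z∈ = ∈-leaves-step⁻ t p (∈-leaves-applyPairs⁻ ps (step t p) z∈)

∈-leaves-applyPairs⁺ : ∀ ps t {z} → z ∈ leaves t →
                       z ∈ leaves (applyPairs ps t) ⊎ z ∈ map proj₁ ps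
∈-leaves-applyPairs⁺ []             t z∈ = inj₁ z∈
∈-leaves-applyPairs⁺ ((a , b) ∷ ps) t {z} z∈ with z ≟ a
... | yes z≡a = inj₂ (here z≡a)
... | no  z≢a with ∈-leaves-applyPairs⁺ ps (step t (a , b)) (∈-leaves-step⁺ t (a , b) z∈ z≢a)
...   | inj₁ z∈t′ = inj₁ z∈t′
...   | inj₂ z∈ps = inj₂ (there z∈ps)

∈-leaves-applyPairs⁺′ : ∀ ps t {z} → z ∈ leaves t → z ∉ map proj₁ ps →
                        z ∈ leaves (applyPairs ps t)
∈-leaves-applyPairs⁺′ ps t z∈ z∉ with ∈-leaves-applyPairs⁺ ps t z∈
... | inj₁ z∈t′ = z∈t′
... | inj₂ z∈ps = ⊥-elim (z∉ z∈ps)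

Unique-++⁻ : ∀ {A : Set} (xs : List A) {ys} → Unique (xs ++ ys) → Unique xs × Unique ys × Disjoint xs ys
Unique-++⁻ []       u          = [] , u , λ ()
Unique-++⁻ (x ∷ xs) (x∉ ∷ u) with Unique-++⁻ xs u
... | uxs , uys , disj = All.++⁻ˡ xs x∉ ∷ uxs , uys , λ where
  (here refl , z∈ys)  → All.lookup (All.++⁻ʳ xs x∉) z∈ys refl
  (there z∈xs , z∈ys) → disj (z∈xs , z∈ys)

Distinct : Tree → Set
Distinct (leaf _)   = ⊤
Distinct (node l r) = Distinct l × Distinct r × Disjoint (leaves l) (leaves r)

Unique⇒Distinct : ∀ t → Unique (leaves t) → Distinct t
Unique⇒Distinct (leaf _)   _ = tt
Unique⇒Distinct (node l r) u with Unique-++⁻ (leaves l) u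
... | ul , ur , disj = Unique⇒Distinct l ul , Unique⇒Distinct r ur , disj

PhyloTree⇒Distinct : ∀ {X t} → Unique X → PhyloTree X t → Distinct t
PhyloTree⇒Distinct {t = t} uX t↭X =
  Unique⇒Distinct t (Perm.Unique-resp-↭ (setoid ℕ) (↭⇒↭ₛ (↭-sym t↭X)) uX)

reduce-Distinct : ∀ a b t → Distinct t → Distinct (reduce a b t)
reduce-Distinct a b (leaf _)   d = d
reduce-Distinct a b (node l r) (dl , dr , disj) with cherryNode? a b l r
... | yes c rewrite reduce-picks c = tt
... | no ¬c rewrite reduce-skips ¬c =
  reduce-Distinct a b l dl , reduce-Distinct a b r dr ,
  λ (z∈l , z∈r) → disj (∈-leaves-reduce⁻ a b l z∈l , ∈-leaves-reduce⁻ a b r z∈r)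

step-Distinct : ∀ t p → Distinct t → Distinct (step t p)
step-Distinct t (a , b) d with hasCherry? a b t
... | yes h rewrite step-picks h = reduce-Distinct a b t d
... | no ¬h rewrite step-skips ¬h = d

applyPairs-Distinct : ∀ ps t → Distinct t → Distinct (applyPairs ps t)
applyPairs-Distinct []       t d = d
applyPairs-Distinct (p ∷ ps) t d = applyPairs-Distinct ps (step t p) (step-Distinct t p d)

HasCherryˡ⇒∉ʳ : ∀ {a b l r} → Distinct (node l r) → HasCherry a b l → a ∉ leaves r × b ∉ leaves r
HasCherryˡ⇒∉ʳ (_ , _ , disj) h = let a∈ , b∈ = HasCherry⇒∈leaves h in
  (λ a∈r → disj (a∈ , a∈r)) , (λ b∈r → disj (b∈ , b∈r))

HasCherryʳ⇒∉ˡ : ∀ {a b l r} → Distinct (node l r) → HasCherry a b r → a ∉ leaves l × b ∉ leaves l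
HasCherryʳ⇒∉ˡ (_ , _ , disj) h = let a∈ , b∈ = HasCherry⇒∈leaves h in
  (λ a∈l → disj (a∈l , a∈)) , (λ b∈l → disj (b∈l , b∈))

HasCherry-irrefl : ∀ {a t} → Distinct t → ¬ HasCherry a a t
HasCherry-irrefl (_ , _ , disj) (root ab)  = disj (here refl , here refl)
HasCherry-irrefl (_ , _ , disj) (root ba)  = disj (here refl , here refl)
HasCherry-irrefl (dl , _ , _)   (left h)   = HasCherry-irrefl dl h
HasCherry-irrefl (_ , dr , _)   (right h)  = HasCherry-irrefl dr h

sibling-unique : ∀ {a b c t} → Distinct t → HasCherry a b t → HasCherry a c t → b ≡ c
sibling-unique _ (root ab) (root ab) = refl
sibling-unique _ (root ab) (root ba) = refl
sibling-unique _ (root ba) (root ab) = refl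
sibling-unique _ (root ba) (root ba) = refl
sibling-unique _ (root c)   (left h)   = ⊥-elim (HasCherry⇒¬CherryNodeˡ h c)
sibling-unique _ (root c)   (right h)  = ⊥-elim (HasCherry⇒¬CherryNodeʳ h c)
sibling-unique _ (left h)   (root c)   = ⊥-elim (HasCherry⇒¬CherryNodeˡ h c)
sibling-unique _ (right h)  (root c)   = ⊥-elim (HasCherry⇒¬CherryNodeʳ h c)
sibling-unique (dl , _ , _) (left h₁)  (left h₂)  = sibling-unique dl h₁ h₂
sibling-unique (_ , dr , _) (right h₁) (right h₂) = sibling-unique dr h₁ h₂
sibling-unique d (left h₁)  (right h₂) =
  ⊥-elim (proj₁ (HasCherryˡ⇒∉ʳ d h₁) (proj₁ (HasCherry⇒∈leaves h₂)))
sibling-unique d (right h₁) (left h₂)  =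
  ⊥-elim (proj₁ (HasCherryˡ⇒∉ʳ d h₂) (proj₁ (HasCherry⇒∈leaves h₁)))

reduce-fresh : ∀ a b t → a ∉ leaves t → reduce a b t ≡ t
reduce-fresh a b (leaf _)   _   = refl
reduce-fresh a b (node l r) a∉ with cherryNode? a b l r
... | yes c = ⊥-elim (a∉ (proj₁ (HasCherry⇒∈leaves (root c))))
... | no ¬c rewrite reduce-skips ¬c =
  cong₂ node (reduce-fresh a b l (a∉ ∘ ∈-++⁺ˡ)) (reduce-fresh a b r (a∉ ∘ ∈-++⁺ʳ (leaves l)))

∉-leaves-reduce : ∀ {a b t} → Distinct t → HasCherry a b t → a ∉ leaves (reduce a b t)
∉-leaves-reduce {a} d (root c) a∈ with subst (λ t → a ∈ leaves t) (reduce-picks c) a∈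
... | here refl = HasCherry-irrefl d (root c)
∉-leaves-reduce {a} {b} {node l r} d@(dl , _ , _) (left h) a∈
  rewrite reduce-skips (HasCherry⇒¬CherryNodeˡ {a = a} {b} {r = r} h) with ∈-++⁻ (leaves (reduce a b l)) a∈
... | inj₁ a∈l = ∉-leaves-reduce dl h a∈l
... | inj₂ a∈r = proj₁ (HasCherryˡ⇒∉ʳ d h) (∈-leaves-reduce⁻ a b r a∈r)
∉-leaves-reduce {a} {b} {node l r} d@(_ , dr , _) (right h) a∈
  rewrite reduce-skips (HasCherry⇒¬CherryNodeʳ {a = a} {b} {l} h) with ∈-++⁻ (leaves (reduce a b l)) a∈
... | inj₁ a∈l = proj₁ (HasCherryʳ⇒∉ˡ d h) (∈-leaves-reduce⁻ a b l a∈l)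
... | inj₂ a∈r = ∉-leaves-reduce dr h a∈r

CherryNode⇒leafˡ : ∀ {u v l r} → CherryNode u v l r → ∃ λ z → l ≡ leaf z × z ∈ u ∷ v ∷ []
CherryNode⇒leafˡ ab = _ , refl , here refl
CherryNode⇒leafˡ ba = _ , refl , there (here refl)

CherryNode⇒leafʳ : ∀ {u v l r} → CherryNode u v l r → ∃ λ z → r ≡ leaf z × z ∈ u ∷ v ∷ []
CherryNode⇒leafʳ ab = _ , refl , there (here refl)
CherryNode⇒leafʳ ba = _ , refl , here refl

reduce-node≡leaf : ∀ a b l r {z} → reduce a b (node l r) ≡ leaf z → z ≡ b
reduce-node≡leaf a b l r e with cherryNode? a b l r
... | yes c rewrite reduce-picks c with e
...   | refl = refl
reduce-node≡leaf a b l r e | no ¬c rewrite reduce-skips ¬c with e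
...   | ()

CherryNode-reduce⁺ : ∀ {u v a b l r} → CherryNode u v l r → CherryNode u v (reduce a b l) (reduce a b r)
CherryNode-reduce⁺ ab = ab
CherryNode-reduce⁺ ba = ba

CherryNode-reduce⁻ : ∀ {u v a b l r} → b ∉ u ∷ v ∷ [] →
                     CherryNode u v (reduce a b l) (reduce a b r) → CherryNode u v l r
CherryNode-reduce⁻ {l = leaf _} {r = leaf _} _ c = c
CherryNode-reduce⁻ {a = a} {b} {l = node l₁ l₂} b∉ c =
  let _ , e , z∈ = CherryNode⇒leafˡ c in ⊥-elim (b∉ (subst (_∈ _) (reduce-node≡leaf a b l₁ l₂ e) z∈))
CherryNode-reduce⁻ {a = a} {b} {l = leaf _} {r = node r₁ r₂} b∉ c =
  let _ , e , z∈ = CherryNode⇒leafʳ c in ⊥-elim (b∉ (subst (_∈ _) (reduce-node≡leaf a b r₁ r₂ e) z∈))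

HasCherry-reduce⁺ : ∀ {u v a b t} → a ∉ u ∷ v ∷ [] → HasCherry u v t → HasCherry u v (reduce a b t)
HasCherry-reduce⁺ {a = a} {b} a∉ (root ab)
  rewrite reduce-skips {a} {b} (a∉ ∘ CherryNode⇒∈ ab) = root ab
HasCherry-reduce⁺ {a = a} {b} a∉ (root ba)
  rewrite reduce-skips {a} {b} (a∉ ∘ CherryNode⇒∈ ba) = root ba
HasCherry-reduce⁺ {a = a} {b} {node l r} a∉ (left h)
  rewrite reduce-skips {a} {b} {l} {r} (HasCherry⇒¬CherryNodeˡ h) = left (HasCherry-reduce⁺ a∉ h)
HasCherry-reduce⁺ {a = a} {b} {node l r} a∉ (right h)
  rewrite reduce-skips {a} {b} {l} {r} (HasCherry⇒¬CherryNodeʳ h) = right (HasCherry-reduce⁺ a∉ h)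

HasCherry-reduce⁻ : ∀ {u v a b} t → b ∉ u ∷ v ∷ [] → HasCherry u v (reduce a b t) → HasCherry u v t
HasCherry-reduce⁻ {a = a} {b} (node l r) b∉ h with cherryNode? a b l r
... | yes c rewrite reduce-picks c = ⊥-elim (¬HasCherry-leaf h)
... | no ¬c rewrite reduce-skips ¬c with h
...   | root c   = root (CherryNode-reduce⁻ b∉ c)
...   | left h′  = left (HasCherry-reduce⁻ l b∉ h′)
...   | right h′ = right (HasCherry-reduce⁻ r b∉ h′)

reduce-comm : ∀ {a b x y} t → Disjoint (a ∷ b ∷ []) (x ∷ y ∷ []) →
              reduce x y (reduce a b t) ≡ reduce a b (reduce x y t)
reduce-comm (leaf _) _ = refl
reduce-comm {a} {b} {x} {y} (node l r) disj with cherryNode? a b l r | cherryNode? x y l r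
... | yes c | yes c′ = ⊥-elim (disj (here refl , CherryNode⇒∈ c′ c))
... | yes c | no ¬c′
  rewrite reduce-picks c | reduce-skips ¬c′ | reduce-picks (CherryNode-reduce⁺ {a = x} {y} c) = refl
... | no ¬c | yes c′
  rewrite reduce-picks c′ | reduce-skips ¬c | reduce-picks (CherryNode-reduce⁺ {a = a} {b} c′) = refl
... | no ¬c | no ¬c′
  rewrite reduce-skips ¬c | reduce-skips ¬c′
        | reduce-skips (¬c′ ∘ CherryNode-reduce⁻ {a = a} λ b∈ → disj (there (here refl) , b∈))
        | reduce-skips (¬c ∘ CherryNode-reduce⁻ {a = x} λ y∈ → disj (y∈ , there (here refl)))
  = cong₂ node (reduce-comm l disj) (reduce-comm r disj)

relabel : (ℕ → ℕ) → Tree → Tree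
relabel f (leaf z)   = leaf (f z)
relabel f (node l r) = node (relabel f l) (relabel f r)

relabel-fresh : ∀ {f} t → (∀ {z} → z ∈ leaves t → f z ≡ z) → relabel f t ≡ t
relabel-fresh (leaf z)   fix = cong leaf (fix (here refl))
relabel-fresh (node l r) fix =
  cong₂ node (relabel-fresh l (fix ∘ ∈-++⁺ˡ)) (relabel-fresh r (fix ∘ ∈-++⁺ʳ (leaves l)))

relabel-involutive : ∀ {f} → (∀ z → f (f z) ≡ z) → ∀ t → relabel f (relabel f t) ≡ t
relabel-involutive inv (leaf z)   = cong leaf (inv z)
relabel-involutive inv (node l r) = cong₂ node (relabel-involutive inv l) (relabel-involutive inv r)

CherryNode-relabel⁺ : ∀ {f a b l r} → CherryNode a b l r → CherryNode (f a) (f b) (relabel f l) (relabel f r)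
CherryNode-relabel⁺ ab = ab
CherryNode-relabel⁺ ba = ba

HasCherry-relabel⁺ : ∀ {f a b t} → HasCherry a b t → HasCherry (f a) (f b) (relabel f t)
HasCherry-relabel⁺ (root c)  = root (CherryNode-relabel⁺ c)
HasCherry-relabel⁺ (left h)  = left (HasCherry-relabel⁺ h)
HasCherry-relabel⁺ (right h) = right (HasCherry-relabel⁺ h)

module _ {f : ℕ → ℕ} (f-inj : Injective _≡_ _≡_ f) where

  CherryNode-relabel⁻ : ∀ {a b} l r → CherryNode (f a) (f b) (relabel f l) (relabel f r) →
                        CherryNode a b l r
  CherryNode-relabel⁻ (leaf p) (leaf q) c with CherryNode-leaves⁻ c
  ... | inj₁ (fp≡fa , fq≡fb) rewrite f-inj fp≡fa | f-inj fq≡fb = ab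
  ... | inj₂ (fp≡fb , fq≡fa) rewrite f-inj fp≡fb | f-inj fq≡fa = ba

  HasCherry-relabel⁻ : ∀ {a b} t → HasCherry (f a) (f b) (relabel f t) → HasCherry a b t
  HasCherry-relabel⁻ (node l r) (root c)  = root (CherryNode-relabel⁻ l r c)
  HasCherry-relabel⁻ (node l r) (left h)  = left (HasCherry-relabel⁻ l h)
  HasCherry-relabel⁻ (node l r) (right h) = right (HasCherry-relabel⁻ r h)

  reduce-relabel : ∀ a b t → reduce (f a) (f b) (relabel f t) ≡ relabel f (reduce a b t)
  reduce-relabel a b (leaf _)   = refl
  reduce-relabel a b (node l r) with cherryNode? a b l r
  ... | yes c rewrite reduce-picks (CherryNode-relabel⁺ {f} c) | reduce-picks c = refl
  ... | no ¬c rewrite reduce-skips ¬c | reduce-skips (¬c ∘ CherryNode-relabel⁻ l r) =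
    cong₂ node (reduce-relabel a b l) (reduce-relabel a b r)

  step-relabel : ∀ a b t → step (relabel f t) (f a , f b) ≡ relabel f (step t (a , b))
  step-relabel a b t with hasCherry? a b t
  ... | yes h rewrite step-picks h | step-picks (HasCherry-relabel⁺ {f} h) = reduce-relabel a b t
  ... | no ¬h rewrite step-skips ¬h | step-skips (¬h ∘ HasCherry-relabel⁻ t) = refl

  applyPairs-relabel : ∀ ps t →
    applyPairs (map (Product.map f f) ps) (relabel f t) ≡ relabel f (applyPairs ps t)
  applyPairs-relabel []             t = refl
  applyPairs-relabel ((a , b) ∷ ps) t rewrite step-relabel a b t = applyPairs-relabel ps (step t (a , b))

transpose : ℕ → ℕ → ℕ → ℕ
transpose x y z with z ≟ x | z ≟ y
... | yes _ | _     = y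
... | no _  | yes _ = x
... | no _  | no _  = z

module _ {x y : ℕ} where

  transpose-x : transpose x y x ≡ y
  transpose-x with x ≟ x
  ... | yes _   = refl
  ... | no x≢x = ⊥-elim (x≢x refl)

  transpose-y : transpose x y y ≡ x
  transpose-y with y ≟ x | y ≟ y
  ... | yes y≡x | _       = y≡x
  ... | no _    | yes _   = refl
  ... | no _    | no y≢y = ⊥-elim (y≢y refl)

  transpose-other : ∀ {z} → z ≢ x → z ≢ y → transpose x y z ≡ z
  transpose-other {z} z≢x z≢y with z ≟ x | z ≟ y
  ... | yes z≡x | _       = ⊥-elim (z≢x z≡x)
  ... | no _    | yes z≡y = ⊥-elim (z≢y z≡y)
  ... | no _    | no _    = refl

  transpose-involutive : ∀ z → transpose x y (transpose x y z) ≡ z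
  transpose-involutive z with z ≟ x | z ≟ y
  ... | yes refl | _        = transpose-y
  ... | no _     | yes refl = transpose-x
  ... | no z≢x   | no z≢y   = transpose-other z≢x z≢y

  transpose-injective : Injective _≡_ _≡_ (transpose x y)
  transpose-injective {a} {b} e =
    trans (sym (transpose-involutive a)) (trans (cong (transpose x y) e) (transpose-involutive b))

  transpose-∈ : ∀ {X z} → x ∈ X → y ∈ X → z ∈ X → transpose x y z ∈ X
  transpose-∈ {z = z} x∈X y∈X z∈X with z ≟ x | z ≟ y
  ... | yes _ | _     = y∈X
  ... | no _  | yes _ = x∈X
  ... | no _  | no _  = z∈X

  transpose-fresh : ∀ t → x ∉ leaves t → y ∉ leaves t → relabel (transpose x y) t ≡ t
  transpose-fresh t x∉ y∉ =
    relabel-fresh t λ z∈ → transpose-other (λ where refl → x∉ z∈) (λ where refl → y∉ z∈)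

  reduce-flip : ∀ {t} → Distinct t → HasCherry x y t →
                reduce y x t ≡ relabel (transpose x y) (reduce x y t)
  reduce-flip _ (root c)
    rewrite reduce-picks (CherryNode-sym c) | reduce-picks c = cong leaf (sym transpose-y)
  reduce-flip {node l r} d@(dl , _ , _) (left h) with HasCherryˡ⇒∉ʳ d h
  ... | x∉r , y∉r
    rewrite reduce-skips {y} {x} {l} {r} (HasCherry⇒¬CherryNodeˡ h)
          | reduce-skips {x} {y} {l} {r} (HasCherry⇒¬CherryNodeˡ h)
          | reduce-fresh y x r y∉r | reduce-fresh x y r x∉r
    = cong₂ node (reduce-flip dl h) (sym (transpose-fresh r x∉r y∉r))
  reduce-flip {node l r} d@(_ , dr , _) (right h) with HasCherryʳ⇒∉ˡ d h
  ... | x∉l , y∉l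
    rewrite reduce-skips {y} {x} {l} {r} (HasCherry⇒¬CherryNodeʳ h)
          | reduce-skips {x} {y} {l} {r} (HasCherry⇒¬CherryNodeʳ h)
          | reduce-fresh y x l y∉l | reduce-fresh x y l x∉l
    = cong₂ node (sym (transpose-fresh l x∉l y∉l)) (reduce-flip dr h)

TreeChildFrom : List ℕ → List (ℕ × ℕ) → Set
TreeChildFrom F []             = ⊤
TreeChildFrom F ((a , b) ∷ ps) = b ∉ F × TreeChildFrom (F ++ [ a ]) ps

TreeChildFrom-antitone : ∀ {F G} ps → G ⊆ F → TreeChildFrom F ps → TreeChildFrom G ps
TreeChildFrom-antitone []             _   _          = tt
TreeChildFrom-antitone ((a , b) ∷ ps) G⊆F (b∉F , tc) =
  b∉F ∘ G⊆F , TreeChildFrom-antitone ps (Subset.++⁺ˡ [ a ] G⊆F) tc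

TreeChildFrom-++⁻ : ∀ {F R} P → TreeChildFrom F (P ++ R) →
                    TreeChildFrom F P × TreeChildFrom (F ++ map proj₁ P) R
TreeChildFrom-++⁻ {F} {R} []            tc        = tt , subst (λ G → TreeChildFrom G R) (sym (++-identityʳ F)) tc
TreeChildFrom-++⁻ {F} {R} ((a , b) ∷ P) (b∉ , tc) =
  let tcP , tcR = TreeChildFrom-++⁻ P tc in
  (b∉ , tcP) , subst (λ G → TreeChildFrom G R) (++-assoc F [ a ] (map proj₁ P)) tcR

TreeChildFrom-++⁺ : ∀ {F R} P → TreeChildFrom F P → TreeChildFrom (F ++ map proj₁ P) R →
                    TreeChildFrom F (P ++ R)
TreeChildFrom-++⁺ {F} {R} []            _          tcR = subst (λ G → TreeChildFrom G R) (++-identityʳ F) tcR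
TreeChildFrom-++⁺ {F} {R} ((a , b) ∷ P) (b∉ , tcP) tcR =
  b∉ , TreeChildFrom-++⁺ P tcP (subst (λ G → TreeChildFrom G R) (sym (++-assoc F [ a ] (map proj₁ P))) tcR)

TreeChildFrom-relabel : ∀ {f} → Injective _≡_ _≡_ f → ∀ {F} ps → TreeChildFrom F ps →
                        TreeChildFrom (map f F) (map (Product.map f f) ps)
TreeChildFrom-relabel f-inj []                     _          = tt
TreeChildFrom-relabel {f} f-inj {F} ((a , b) ∷ ps) (b∉F , tc) =
  fb∉ , subst (λ G → TreeChildFrom G _) (map-++ f F [ a ]) (TreeChildFrom-relabel f-inj ps tc)
  where
  fb∉ : f b ∉ map f F
  fb∉ fb∈ with ∈-map⁻ f fb∈
  ... | z , z∈F , fb≡fz = b∉F (subst (_∈ F) (sym (f-inj fb≡fz)) z∈F)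

TreeChildFrom⇒treeChild : ∀ {F} ps → TreeChildFrom F ps →
  ∀ pre p post → ps ≡ pre ++ p ∷ post → proj₂ p ∉ F ++ map proj₁ pre
TreeChildFrom⇒treeChild {F} ((a , b) ∷ ps) (b∉ , _) [] _ _ refl =
  b∉ ∘ subst (b ∈_) (++-identityʳ F)
TreeChildFrom⇒treeChild {F} ((a , b) ∷ ps) (_ , tc) (_ ∷ pre) p post refl =
  TreeChildFrom⇒treeChild ps tc pre p post refl ∘ subst (proj₂ p ∈_) (sym (++-assoc F [ a ] (map proj₁ pre)))

treeChild⇒TreeChildFrom : ∀ {F} ps →
  (∀ pre p post → ps ≡ pre ++ p ∷ post → proj₂ p ∉ F ++ map proj₁ pre) → TreeChildFrom F ps
treeChild⇒TreeChildFrom     []             _  = tt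
treeChild⇒TreeChildFrom {F} ((a , b) ∷ ps) tc =
  tc [] (a , b) ps refl ∘ subst (b ∈_) (sym (++-identityʳ F)) ,
  treeChild⇒TreeChildFrom ps λ pre p post e →
    tc ((a , b) ∷ pre) p post (cong ((a , b) ∷_) e) ∘ subst (proj₂ p ∈_) (++-assoc F [ a ] (map proj₁ pre))

_≟ₚ_ : (p q : ℕ × ℕ) → Dec (p ≡ q)
_≟ₚ_ = ≡-dec _≟_ _≟_

first-occurrence : ∀ (p : ℕ × ℕ) L → p ∉ L ⊎ ∃₂ λ A B → L ≡ A ++ p ∷ B × p ∉ A
first-occurrence p L with First.first (λ q → Sum.swap (toSum (p ≟ₚ q))) L
... | inj₂ none = inj₁ (All.All¬⇒¬Any none)
... | inj₁ found with toView found
...   | First._++_∷_ A refl B = inj₂ (_ , B , refl , All.All¬⇒¬Any A)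

take-++-length : ∀ {A : Set} (xs ys : List A) → take (length xs) (xs ++ ys) ≡ xs
take-++-length []       ys = refl
take-++-length (x ∷ xs) ys = cong (x ∷_) (take-++-length xs ys)

drop-++-length : ∀ {A : Set} (xs ys : List A) → drop (length xs) (xs ++ ys) ≡ ys
drop-++-length []       ys = refl
drop-++-length (x ∷ xs) ys = drop-++-length xs ys

picked-or-final : ∀ {X t z} ps → PhyloTree X t → applyPairs ps t ≡ leaf z →
                  ∀ {w} → w ∈ X → w ∈ map proj₁ ps ++ [ z ]
picked-or-final {t = t} ps t↭X reduced w∈X with ∈-leaves-applyPairs⁺ ps t (∈-resp-↭ (↭-sym t↭X) w∈X)
... | inj₁ w∈t′ rewrite reduced = ∈-++⁺ʳ (map proj₁ ps) w∈t′
... | inj₂ w∈ps = ∈-++⁺ˡ w∈ps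

cherry-labels : ∀ {X T x y} P → Unique X → PhyloTree X T → HasCherry x y (applyPairs P T) →
                x ∈ X × y ∈ X × x ≢ y
cherry-labels {X} {T} P uX T↭X h =
  ∈X (proj₁ (HasCherry⇒∈leaves h)) , ∈X (proj₂ (HasCherry⇒∈leaves h)) ,
  λ where refl → HasCherry-irrefl (applyPairs-Distinct P T (PhyloTree⇒Distinct uX T↭X)) h
  where
  ∈X : ∀ {z} → z ∈ leaves (applyPairs P T) → z ∈ X
  ∈X = ∈-resp-↭ T↭X ∘ ∈-leaves-applyPairs⁻ P T

cherry-in-every-tree : ∀ {X Ts x y} P → All (PhyloTree X) Ts → TrivialCherry x y (applySet P Ts) →
                       x ∈ X → y ∈ X → x ∉ map proj₁ P → y ∉ map proj₁ P →
                       All (λ T → HasCherry x y (applyPairs P T)) Ts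
cherry-in-every-tree P phy (_ , trivial) x∈X y∈X x∉P y∉P =
  All.zipWith (λ where (T↭X , cherry-if-present) → Cherry⇒HasCherry _
                         (cherry-if-present (survives T↭X x∈X x∉P) (survives T↭X y∈X y∉P)))
              (phy , All.map⁻ trivial)
  where
  survives : ∀ {X T z} → PhyloTree X T → z ∈ X → z ∉ map proj₁ P → z ∈ leaves (applyPairs P T)
  survives {T = T} T↭X z∈X = ∈-leaves-applyPairs⁺′ P T (∈-resp-↭ (↭-sym T↭X) z∈X)

module Rearrangement (x y : ℕ) where

  Touches : ℕ × ℕ → Set
  Touches (a , b) = a ∈ x ∷ y ∷ [] ⊎ b ∈ x ∷ y ∷ []

  touches? : ∀ p → Dec (Touches p)
  touches? (a , b) = (a ∈? x ∷ y ∷ []) ⊎-dec (b ∈? x ∷ y ∷ [])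

  ¬Touches⇒Disjoint : ∀ {a b} → ¬ Touches (a , b) → Disjoint (a ∷ b ∷ []) (x ∷ y ∷ [])
  ¬Touches⇒Disjoint ¬t (here refl         , z∈xy) = ¬t (inj₁ z∈xy)
  ¬Touches⇒Disjoint ¬t (there (here refl) , z∈xy) = ¬t (inj₂ z∈xy)

  retarget : ℕ × ℕ → ℕ × ℕ
  retarget p with touches? p
  ... | yes _ = x , y
  ... | no _  = p

  σ : ℕ → ℕ
  σ = transpose x y

  rearrange : List (ℕ × ℕ) → List (ℕ × ℕ) → List (ℕ × ℕ)
  rearrange A B = (x , y) ∷ map retarget A ++ map (Product.map σ σ) B

  module _ {V : Tree} (dV : Distinct V) (xy∈V : HasCherry x y V) where

    touching-not-cherry : ∀ {a b} → Touches (a , b) → (x , y) ≢ (a , b) → (y , x) ≢ (a , b) →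
                          ¬ HasCherry a b V
    touching-not-cherry (inj₁ (here refl)) ≢xy _ h =
      ≢xy (cong (x ,_) (sibling-unique dV xy∈V h))
    touching-not-cherry (inj₁ (there (here refl))) _ ≢yx h =
      ≢yx (cong (y ,_) (sibling-unique dV (HasCherry-sym xy∈V) h))
    touching-not-cherry (inj₂ (here refl)) _ ≢yx h =
      ≢yx (cong (_, x) (sibling-unique dV xy∈V (HasCherry-sym h)))
    touching-not-cherry (inj₂ (there (here refl))) ≢xy _ h =
      ≢xy (cong (_, y) (sibling-unique dV (HasCherry-sym xy∈V) (HasCherry-sym h)))

    cherry-survives-step : ∀ {a b} → (x , y) ≢ (a , b) → (y , x) ≢ (a , b) →
                           HasCherry x y (step V (a , b))
    cherry-survives-step {a} {b} ≢xy ≢yx with touches? (a , b) | hasCherry? a b V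
    ... | yes t | yes h = ⊥-elim (touching-not-cherry t ≢xy ≢yx h)
    ... | no ¬t | yes h rewrite step-picks h =
      HasCherry-reduce⁺ (λ a∈xy → ¬Touches⇒Disjoint ¬t (here refl , a∈xy)) xy∈V
    ... | _     | no ¬h rewrite step-skips ¬h = xy∈V

    retarget-step : ∀ {a b} → (x , y) ≢ (a , b) → (y , x) ≢ (a , b) →
                    step (reduce x y V) (retarget (a , b)) ≡ reduce x y (step V (a , b))
    retarget-step {a} {b} ≢xy ≢yx with touches? (a , b)
    ... | yes t rewrite step-skips (touching-not-cherry t ≢xy ≢yx) =
      step-skips λ h → ∉-leaves-reduce dV xy∈V (proj₁ (HasCherry⇒∈leaves h))
    ... | no ¬t with hasCherry? a b V
    ...   | yes h
      rewrite step-picks h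
            | step-picks (HasCherry-reduce⁺ {b = y} (λ x∈ab → ¬Touches⇒Disjoint ¬t (x∈ab , here refl)) h)
      = sym (reduce-comm V (¬Touches⇒Disjoint ¬t))
    ...   | no ¬h rewrite step-skips ¬h =
      step-skips (¬h ∘ HasCherry-reduce⁻ V λ y∈ab → ¬Touches⇒Disjoint ¬t (y∈ab , there (here refl)))

  cherry-survives : ∀ A {V} → Distinct V → HasCherry x y V → (x , y) ∉ A → (y , x) ∉ A →
                    HasCherry x y (applyPairs A V)
  cherry-survives []          _  xy∈V _   _   = xy∈V
  cherry-survives (p ∷ A) {V} dV xy∈V xy∉ yx∉ =
    cherry-survives A (step-Distinct V p dV) (cherry-survives-step dV xy∈V (xy∉ ∘ here) (yx∉ ∘ here))
      (xy∉ ∘ there) (yx∉ ∘ there)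

  retarget-applyPairs : ∀ A {V} → Distinct V → HasCherry x y V → (x , y) ∉ A → (y , x) ∉ A →
                        applyPairs (map retarget A) (reduce x y V) ≡ reduce x y (applyPairs A V)
  retarget-applyPairs []          _  _    _   _   = refl
  retarget-applyPairs (p ∷ A) {V} dV xy∈V xy∉ yx∉ =
    trans (cong (applyPairs (map retarget A)) (retarget-step dV xy∈V (xy∉ ∘ here) (yx∉ ∘ here)))
          (retarget-applyPairs A (step-Distinct V p dV) (cherry-survives-step dV xy∈V (xy∉ ∘ here) (yx∉ ∘ here))
            (xy∉ ∘ there) (yx∉ ∘ there))

  cherry-eventually-picked : ∀ j ps {X T z} → Unique X → PhyloTree X T →
    HasCherry x y (applyPairs (take j ps) T) → applyPairs ps T ≡ leaf z →
    (x , y) ∈ drop j ps ⊎ ∃₂ λ A B → drop j ps ≡ A ++ (y , x) ∷ B × (x , y) ∉ A × (y , x) ∉ A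
  cherry-eventually-picked j ps {T = T} uX T↭X xy∈U reduced with any? ((x , y) ≟ₚ_) (drop j ps)
  ... | yes xy∈Q = inj₁ xy∈Q
  ... | no xy∉Q with first-occurrence (y , x) (drop j ps)
  ...   | inj₂ (A , B , Q≡ , yx∉A) =
    inj₂ (A , B , Q≡ , xy∉Q ∘ subst ((x , y) ∈_) (sym Q≡) ∘ ∈-++⁺ˡ , yx∉A)
  ...   | inj₁ yx∉Q =
    ⊥-elim (¬HasCherry-leaf (subst (HasCherry x y) reducedQ (cherry-survives (drop j ps) dU xy∈U xy∉Q yx∉Q)))
    where
    dU : Distinct (applyPairs (take j ps) T)
    dU = applyPairs-Distinct (take j ps) T (PhyloTree⇒Distinct uX T↭X)
    reducedQ : applyPairs (drop j ps) (applyPairs (take j ps) T) ≡ leaf _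
    reducedQ = trans (sym (foldl-++ step T (take j ps) (drop j ps)))
                     (trans (cong (λ qs → applyPairs qs T) (take++drop≡id j ps)) reduced)

  applyPairs-rearrange : ∀ A B {U} → Distinct U → HasCherry x y U → (x , y) ∉ A → (y , x) ∉ A →
    applyPairs (rearrange A B) U ≡ relabel σ (applyPairs (A ++ (y , x) ∷ B) U)
  applyPairs-rearrange A B {U} dU xy∈U xy∉ yx∉ = begin
      applyPairs (map retarget A ++ σB) (step U (x , y))
    ≡⟨ cong (applyPairs (map retarget A ++ σB)) (step-picks xy∈U) ⟩
      applyPairs (map retarget A ++ σB) (reduce x y U)
    ≡⟨ foldl-++ step (reduce x y U) (map retarget A) σB ⟩
      applyPairs σB (applyPairs (map retarget A) (reduce x y U))
    ≡⟨ cong (applyPairs σB) (retarget-applyPairs A dU xy∈U xy∉ yx∉) ⟩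
      applyPairs σB (reduce x y V)
    ≡⟨ cong (applyPairs σB) (sym (relabel-involutive transpose-involutive (reduce x y V))) ⟩
      applyPairs σB (relabel σ (relabel σ (reduce x y V)))
    ≡⟨ cong (applyPairs σB ∘ relabel σ) (sym (reduce-flip dV xy∈V)) ⟩
      applyPairs σB (relabel σ (reduce y x V))
    ≡⟨ applyPairs-relabel transpose-injective B (reduce y x V) ⟩
      relabel σ (applyPairs B (reduce y x V))
    ≡⟨ cong (relabel σ ∘ applyPairs B) (sym (step-picks (HasCherry-sym xy∈V))) ⟩
      relabel σ (applyPairs ((y , x) ∷ B) V)
    ≡⟨ cong (relabel σ) (sym (foldl-++ step U A ((y , x) ∷ B))) ⟩
      relabel σ (applyPairs (A ++ (y , x) ∷ B) U)
    ∎
    where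
    open ≡-Reasoning
    σB : List (ℕ × ℕ)
    σB = map (Product.map σ σ) B
    V : Tree
    V = applyPairs A U
    dV : Distinct V
    dV = applyPairs-Distinct A U dU
    xy∈V : HasCherry x y V
    xy∈V = cherry-survives A dU xy∈U xy∉ yx∉

  private
    ⊆-snoc : ∀ {H F a c} → H ⊆ x ∷ F → c ∈ x ∷ F ++ [ a ] → H ++ [ c ] ⊆ x ∷ F ++ [ a ]
    ⊆-snoc {H} {F} {a} H⊆ c∈ z∈ with ∈-++⁻ H z∈
    ... | inj₁ z∈H         = Subset.∷⁺ʳ x (Subset.xs⊆xs++ys F [ a ]) (H⊆ z∈H)
    ... | inj₂ (here refl) = c∈

    ∉-snoc : ∀ {H c} → y ∉ H → y ≢ c → y ∉ H ++ [ c ]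
    ∉-snoc {H} y∉H y≢c y∈ with ∈-++⁻ H y∈
    ... | inj₁ y∈H        = y∉H y∈H
    ... | inj₂ (here y≡c) = y≢c y≡c

  TreeChildFrom-retarget : x ≢ y → ∀ A {B F H} → TreeChildFrom F (A ++ (y , x) ∷ B) →
    H ⊆ x ∷ F → y ∉ H → TreeChildFrom H (map retarget A ++ map (Product.map σ σ) B)
  TreeChildFrom-retarget x≢y [] {B} {F} {H} (x∉F , tcB) H⊆ y∉H =
    TreeChildFrom-antitone (map (Product.map σ σ) B) H⊆σF (TreeChildFrom-relabel transpose-injective B tcB)
    where
    H⊆σF : H ⊆ map σ (F ++ [ y ])
    H⊆σF {z} z∈H with H⊆ z∈H
    ... | here refl = subst (_∈ map σ (F ++ [ y ])) (transpose-y {x} {y})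
                            (∈-map⁺ σ (∈-++⁺ʳ F (here refl)))
    ... | there z∈F = subst (_∈ map σ (F ++ [ y ])) (transpose-other {x} {y} z≢x z≢y)
                            (∈-map⁺ σ (∈-++⁺ˡ z∈F))
      where
      z≢x : z ≢ x
      z≢x refl = x∉F z∈F
      z≢y : z ≢ y
      z≢y refl = y∉H z∈H
  TreeChildFrom-retarget x≢y ((a , b) ∷ A) {F = F} {H} (b∉F , tc) H⊆ y∉H with touches? (a , b)
  ... | yes _ = y∉H , TreeChildFrom-retarget x≢y A tc (⊆-snoc H⊆ (here refl)) (∉-snoc y∉H (x≢y ∘ sym))
  ... | no ¬t = b∉H , TreeChildFrom-retarget x≢y A tc (⊆-snoc H⊆ (there (∈-++⁺ʳ F (here refl))))
                        (∉-snoc y∉H λ y≡a → ¬t (inj₁ (there (here (sym y≡a)))))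
    where
    b∉H : b ∉ H
    b∉H b∈H with H⊆ b∈H
    ... | here b≡x  = ¬t (inj₂ (here b≡x))
    ... | there b∈F = b∉F b∈F

  TreeChildFrom-rearrange : x ≢ y → ∀ A B {F} → TreeChildFrom F (A ++ (y , x) ∷ B) → y ∉ F →
                            TreeChildFrom F (rearrange A B)
  TreeChildFrom-rearrange x≢y A B {F} tc y∉F =
    y∉F , TreeChildFrom-retarget x≢y A tc F++x⊆x∷F (∉-snoc y∉F (x≢y ∘ sym))
    where
    F++x⊆x∷F : F ++ [ x ] ⊆ x ∷ F
    F++x⊆x∷F z∈ with ∈-++⁻ F z∈
    ... | inj₁ z∈F         = there z∈F
    ... | inj₂ (here refl) = here refl

  IsTreeChild-rearrange : x ≢ y → ∀ P A B {fs g} → IsTreeChild (mkSeq (P ++ A ++ (y , x) ∷ B) fs) →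
                          y ∉ map proj₁ P → IsTreeChild (mkSeq (P ++ rearrange A B) [ g ])
  IsTreeChild-rearrange x≢y P A B (_ , tc) y∉P with TreeChildFrom-++⁻ P (treeChild⇒TreeChildFrom {[]} _ tc)
  ... | tcP , tcR = s≤s z≤n , TreeChildFrom⇒treeChild (P ++ rearrange A B)
                                (TreeChildFrom-++⁺ P tcP (TreeChildFrom-rearrange x≢y A B tcR y∉P))

  retarget-∈ : ∀ {X p} → x ∈ X → y ∈ X → proj₁ p ∈ X × proj₂ p ∈ X →
               proj₁ (retarget p) ∈ X × proj₂ (retarget p) ∈ X
  retarget-∈ {p = p} x∈X y∈X p∈X with touches? p
  ... | yes _ = x∈X , y∈X
  ... | no _  = p∈X

  module _ {X : List ℕ} (uX : Unique X) {Ts : List Tree} (phy : All (PhyloTree X) Ts)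
           {P A B : List (ℕ × ℕ)} {f : ℕ}
           (cherries : All (λ T → HasCherry x y (applyPairs P T)) Ts)
           (xy∉A : (x , y) ∉ A) (yx∉A : (y , x) ∉ A) where

    applyPairs-rearrange-leaf : ∀ {T} → PhyloTree X T → HasCherry x y (applyPairs P T) →
      applyPairs (P ++ A ++ (y , x) ∷ B) T ≡ leaf f → applyPairs (P ++ rearrange A B) T ≡ leaf (σ f)
    applyPairs-rearrange-leaf {T} T↭X xy∈T reduced = begin
        applyPairs (P ++ rearrange A B) T
      ≡⟨ foldl-++ step T P (rearrange A B) ⟩
        applyPairs (rearrange A B) (applyPairs P T)
      ≡⟨ applyPairs-rearrange A B (applyPairs-Distinct P T (PhyloTree⇒Distinct uX T↭X)) xy∈T xy∉A yx∉A ⟩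
        relabel σ (applyPairs (A ++ (y , x) ∷ B) (applyPairs P T))
      ≡⟨ cong (relabel σ) (sym (foldl-++ step T P (A ++ (y , x) ∷ B))) ⟩
        relabel σ (applyPairs (P ++ A ++ (y , x) ∷ B) T)
      ≡⟨ cong (relabel σ) reduced ⟩
        leaf (σ f)
      ∎
      where open ≡-Reasoning

    IsCPS-rearrange : IsCPS X Ts (mkSeq (P ++ A ++ (y , x) ∷ B) [ f ]) → x ∈ X → y ∈ X →
                      ∀ {T₀} → T₀ ∈ Ts → IsCPS X Ts (mkSeq (P ++ rearrange A B) [ σ f ])
    IsCPS-rearrange (_ , pairs∈X , f∈X ∷ [] , _ , reductions) x∈X y∈X T₀∈Ts =
      (λ ()) , pairs∈X′ , transpose-∈ x∈X y∈X f∈X ∷ [] , covers , reductions′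
      where
      reductions′ : All (λ T → ∃ λ z → applyPairs (P ++ rearrange A B) T ≡ leaf z × z ∈ [ σ f ]) Ts
      reductions′ = All.zipWith (λ where (T↭X , (_ , reduced , here refl) , xy∈T) →
                                           σ f , applyPairs-rearrange-leaf T↭X xy∈T reduced , here refl)
                                (phy , All.zip (reductions , cherries))
      covers : ∀ z → z ∈ X → z ∈ xsOf (mkSeq (P ++ rearrange A B) [ σ f ])
      covers z z∈X with All.lookup reductions′ T₀∈Ts
      ... | _ , reduced , here refl = picked-or-final (P ++ rearrange A B) (All.lookup phy T₀∈Ts) reduced z∈X
      σ-∈ : ∀ {z} → z ∈ X → σ z ∈ X
      σ-∈ = transpose-∈ x∈X y∈X
      pairs∈X′ : All (λ p → proj₁ p ∈ X × proj₂ p ∈ X) (P ++ rearrange A B)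
      pairs∈X′ with All.++⁻ P pairs∈X
      ... | inP , inR with All.++⁻ A inR
      ...   | inA , _ ∷ inB = All.++⁺ inP ((x∈X , y∈X) ∷ All.++⁺
                (All.map⁺ (All.map (retarget-∈ x∈X y∈X) inA))
                (All.map⁺ (All.map (Product.map σ-∈ σ-∈) inB)))

  length-rearrange : ∀ P A B → length (P ++ rearrange A B) ≡ length (P ++ A ++ (y , x) ∷ B)
  length-rearrange []      A B = trans (cong suc (length-tail A)) (sym (length-++-sucʳ A (y , x) B))
    where
    length-tail : ∀ A → length (map retarget A ++ map (Product.map σ σ) B) ≡ length (A ++ B)
    length-tail []      = length-map _ B
    length-tail (_ ∷ A) = cong suc (length-tail A)
  length-rearrange (_ ∷ P) A B = cong suc (length-rearrange P A B)

  rearrange-shape : ∀ {ps} P A B {f g j} → length P ≡ j → ps ≡ P ++ A ++ (y , x) ∷ B →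
    seqLength (mkSeq (P ++ rearrange A B) [ g ]) ≡ seqLength (mkSeq ps [ f ]) ×
    take j (P ++ rearrange A B) ≡ take j ps ×
    (x , y) ∈ drop j (take (length ps) (P ++ rearrange A B))
  rearrange-shape P A B refl refl rewrite length-rearrange P A B =
    refl ,
    trans (take-++-length P (rearrange A B)) (sym (take-++-length P (A ++ (y , x) ∷ B))) ,
    subst (λ qs → (x , y) ∈ drop (length P) qs)
          (sym (take-all _ (P ++ rearrange A B) (≤-reflexive (length-rearrange P A B))))
          (subst ((x , y) ∈_) (sym (drop-++-length P (rearrange A B))) (here refl))

lemma6 : (X : List ℕ) → Unique X → (Ts : List Tree) → All (PhyloTree X) Ts →
    (S : Seq) → IsCPS X Ts S → IsTreeChild S →
    (j : ℕ) → j ≤ length (pairs S) →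
    (x y : ℕ) → TrivialCherry x y (applySet (take j (pairs S)) Ts) →
    ¬ Forbidden y (take j (pairs S)) →
    ∃ λ S' → IsCPS X Ts S' × IsTreeChild S' ×
      seqLength S' ≡ seqLength S ×
      take j (pairs S') ≡ take j (pairs S) ×
      (x , y) ∈ drop j (take (length (pairs S)) (pairs S'))
lemma6 X uX Ts phy (mkSeq ps [])          (no-final , _) _ _ _ _ _ _ _ = ⊥-elim (no-final refl)
lemma6 X uX Ts phy (mkSeq ps (_ ∷ _ ∷ _)) _ (s≤s () , _) _ _ _ _ _ _
lemma6 X uX Ts phy S@(mkSeq ps (f ∷ [])) cps@(_ , _ , _ , _ , reductions) tc j j≤ x y triv y∉P
  with T₀ , T₀∈Ts , xy∈T₀ ← find (Any.map⁻ (proj₁ triv))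
  with _ , reduced₀ , here refl ← All.lookup reductions T₀∈Ts
  with T₀↭X ← All.lookup phy T₀∈Ts
  with x∈X , y∈X , x≢y ← cherry-labels (take j ps) uX T₀↭X (Cherry⇒HasCherry _ xy∈T₀)
  with Rearrangement.cherry-eventually-picked x y j ps uX T₀↭X (Cherry⇒HasCherry _ xy∈T₀) reduced₀
... | inj₁ xy∈Q =
  S , cps , tc , refl , refl , subst (λ qs → (x , y) ∈ drop j qs) (sym (take-all _ ps ≤-refl)) xy∈Q
... | inj₂ (A , B , Q≡ , xy∉A , yx∉A) =
  mkSeq (P ++ rearrange A B) [ σ f ] ,
  IsCPS-rearrange uX phy cherries xy∉A yx∉A (subst (λ qs → IsCPS X Ts (mkSeq qs [ f ])) ps≡ cps)
                  x∈X y∈X T₀∈Ts ,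
  IsTreeChild-rearrange x≢y P A B {[ f ]} {σ f} (subst (λ qs → IsTreeChild (mkSeq qs [ f ])) ps≡ tc) y∉P ,
  rearrange-shape P A B {f} {σ f} lenP ps≡
  where
  open Rearrangement x y
  P : List (ℕ × ℕ)
  P = take j ps
  ps≡ : ps ≡ P ++ A ++ (y , x) ∷ B
  ps≡ = trans (sym (take++drop≡id j ps)) (cong (P ++_) Q≡)
  lenP : length P ≡ j
  lenP = trans (length-take j ps) (m≤n⇒m⊓n≡m j≤)
  x∉P : x ∉ map proj₁ P
  x∉P = proj₂ tc (P ++ A) (y , x) B (trans ps≡ (sym (++-assoc P A _)))
      ∘ subst (x ∈_) (sym (map-++ proj₁ P A)) ∘ ∈-++⁺ˡ
  cherries : All (λ T → HasCherry x y (applyPairs P T)) Ts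
  cherries = cherry-in-every-tree P phy triv x∈X y∈X x∉P y∉P
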